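{- Consider any sorting network with $n$ inputs and depth $d\ge 1$, and let $k\ge 2$ be an integer. Assume there exists a growing branch $x^1,\dots,x^{k-1}\in\{0,1\}^n$ of length $k-1$ such that for every $x^i$ in the branch there exist at least $2$ cells of array $d-1$ (the cells before the last layer) to which we have access on $x^i$. Then some comparator of the last layer (layer $d$) has size at least $k$.
   Context: A network with $n$ inputs and depth $d$ consists of $d+1$ arrays of cells $c_{a,b}$ ($0\le a\le d$, $1\le b\le n$) and $d$ layers of comparators; layer $a$ ($1\le a\le d$) is a partition of $\{1,\dots,n\}$ into sets called comparators. Given values in the input cells $c_{0,1},\dots,c_{0,n}$, for each comparator $I$ of layer $a$ the values in cells $c_{a-1,i}$, $i\in I$, are sorted in non-decreasing order and written into the cells $c_{a,i}$, $i\in I$, in increasing order of $i$; this inductively defines all cell values. The network is sorting if for every integer input the output array $c_{d,1},\dots,c_{d,n}$ is non-decreasing. For an input $x\in\{0,1\}^n$ and a cell $c$, we say we have access to $c$ on $x$ if $c$ has value $0$ on $x$ and there is an index $i$ with $x_i=0$ such that changing $x_i$ from $0$ to $1$ makes the value of $c$ equal to $1$. A growing branch of length $m$ is a sequence $x^1,\dots,x^m\in\{0,1\}^n$ such that for every $1\le i<m$, $x^{i+1}$ is obtained from $x^i$ by changing one coordinate from $0$ to $1$. -}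

module Defs where

open import Data.Nat using (ℕ; zero; suc; _≤_)
open import Data.Integer using (ℤ; 0ℤ; 1ℤ) renaming (_≤_ to _≤ℤ_)
open import Data.Integer.Properties using (≤-decTotalOrder)
open import Data.Fin using (Fin; toℕ; inject₁; fromℕ) renaming (_<?_ to _<ᶠ?_)
open import Data.Fin.Properties using () renaming (_≟_ to _≟ᶠ_)
open import Data.Bool using (Bool; true; false; if_then_else_)
open import Data.List using (List; []; _∷_; map; filter; length; allFin)
open import Data.Vec using (Vec; []; _∷_; lookup; last)
open import Data.Product using (Σ; _×_; _,_; ∃; ∃-syntax)
open import Relation.Nullary using (¬_; does)
open import Relation.Binary.PropositionalEquality using (_≡_; _≢_)
open import Data.List.Sort ≤-decTotalOrder using (sort)

-- A layer of comparators: a partition of {1..n} (here Fin n), encoded as a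
-- labelling; the comparators are the nonempty fibres, i.e. i and j lie in
-- the same comparator iff  L i ≡ L j.  Every partition arises this way.
Layer : ℕ → Set
Layer n = Fin n → Fin n

Network : ℕ → ℕ → Set
Network n d = Vec (Layer n) d

Array : ℕ → Set
Array n = Fin n → ℤ

comparatorOf : ∀ {n} → Layer n → Fin n → List (Fin n)
comparatorOf {n} L i = filter (λ j → L j ≟ᶠ L i) (allFin n)

-- r-th element of a list (0-based), default 0 (never used out of range).
nth : List ℤ → ℕ → ℤ
nth []       _       = 0ℤ
nth (x ∷ xs) zero    = x
nth (x ∷ xs) (suc r) = nth xs r

-- Apply one layer: inside each comparator I, the values are sorted in
-- non-decreasing order and written back into the cells of I in increasing
-- order of index.
applyLayer : ∀ {n} → Layer n → Array n → Array n
applyLayer L v i =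
  nth (sort (map v (comparatorOf L i)))
      (length (filter (λ j → j <ᶠ? i) (comparatorOf L i)))

arrays : ∀ {n d} → Network n d → Array n → Fin (suc d) → Array n
arrays N        x Fin.zero    = x
arrays (L ∷ N)  x (Fin.suc a) = arrays N (applyLayer L x) a

output : ∀ {n d} → Network n d → Array n → Array n
output {d = d} N x = arrays N x (fromℕ d)

IsSorting : ∀ {n d} → Network n d → Set
IsSorting {n} N = (x : Array n) (i j : Fin n) →
  toℕ i ≤ toℕ j → output N x i ≤ℤ output N x j

BinInput : ℕ → Set
BinInput n = Fin n → Bool

toInt : Bool → ℤ
toInt false = 0ℤ
toInt true  = 1ℤ

embed : ∀ {n} → BinInput n → Array n
embed x i = toInt (x i)

setOne : ∀ {n} → BinInput n → Fin n → BinInput n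
setOne x i j = if does (j ≟ᶠ i) then true else x j

HasAccess : ∀ {n d} → Network n d → BinInput n → Fin (suc d) → Fin n → Set
HasAccess N x a b =
  arrays N (embed x) a b ≡ 0ℤ ×
  ∃[ i ] (x i ≡ false × arrays N (embed (setOne x i)) a b ≡ 1ℤ)

IsGrowingBranch : ∀ {n m} → (Fin m → BinInput n) → Set
IsGrowingBranch {n} {m} xs = (i i' : Fin m) → toℕ i' ≡ suc (toℕ i) →
  ∃[ j ] (xs i j ≡ false × ((l : Fin n) → xs i' l ≡ setOne (xs i) j l))

comparatorSize : ∀ {n} → Layer n → Fin n → ℕ
comparatorSize L i = length (comparatorOf L i)

-- On 0/1 inputs, raising one input bit from 0 to 1 raises exactly one cell of every array.  If a cell a before the last layer
-- is accessible on x, the output cell raised together with it is the last zero β(x) of the sorted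
-- output, which therefore lies in the comparator of a.  Going from x^i to x^(i+1) raises a single
-- penultimate cell c, while a second cell accessible on x^i, different from c, stays accessible on
-- x^(i+1); hence β(x^(i+1)) < β(x^i) lie in one comparator of the last layer.  These k - 1
-- boundaries, followed by one more step from x^(k-1), give k cells of that comparator.

module Submission where

open import Data.Bool using (Bool; true; false; if_then_else_)
open import Data.Empty using (⊥-elim)
open import Data.Fin using (Fin; zero; suc; toℕ; fromℕ; inject₁)
  renaming (_<_ to _<ᶠ_; _≤_ to _≤ᶠ_; _<?_ to _<ᶠ?_)
open import Data.Fin.Properties using (_≟_; <-cmp) renaming (<⇒≢ to <⇒≢ᶠ)
open import Data.Integer using (ℤ; 0ℤ; 1ℤ; +≤+) renaming (_≤_ to _≤ℤ_)
open import Data.Integer.Properties using (≤-decTotalOrder; ≤-totalOrder)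
open import Data.List using (List; []; _∷_; map; replicate; _++_; length; filter; allFin)
open import Data.List.Membership.Propositional using (_∈_)
open import Data.List.Membership.Propositional.Properties using (∈-filter⁺; ∈-filter⁻; ∈-allFin)
open import Data.List.Properties using (map-∘; map-cong; map-cong-local; length-map;
  filter-notAll; filter-accept; filter-reject; filter-none)
open import Data.List.Relation.Binary.Permutation.Propositional
  using (_↭_; prep; ↭-sym; ↭-trans; ↭⇒↭ₛ)
open import Data.List.Relation.Binary.Permutation.Propositional.Properties using (shift)
open import Data.List.Relation.Binary.Pointwise using (Pointwise-≡⇒≡)
import Data.List.Relation.Unary.All as All
import Data.List.Relation.Unary.Any as Any
open import Data.List.Relation.Unary.Any using (here; there)
open import Data.List.Relation.Unary.AllPairs using (AllPairs; []; _∷_)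
import Data.List.Relation.Unary.AllPairs.Properties as AllPairs
open import Data.List.Relation.Unary.Linked using ([]; [-]; _∷_)
open import Data.List.Relation.Unary.Sorted.TotalOrder using (Sorted)
open import Data.List.Relation.Unary.Sorted.TotalOrder.Properties using (↗↭↗⇒≋)
open import Data.List.Sort ≤-decTotalOrder using (sort; sort-↭; sort-↗)
open import Data.Nat using (ℕ; zero; suc; _+_; _∸_; _≤_; _<_; _≤?_; z≤n; s≤s; s≤s⁻¹)
open import Data.Nat.Properties using (≤-refl; +-suc; m≤m+n; n<1+n; n≮n; ≤∧≢⇒<; <⇒≤; <⇒≢; ≤-<-trans; <-trans;
  module ≤-Reasoning)
open import Data.Product using (_×_; _,_; proj₁; proj₂; ∃-syntax)
open import Data.Vec using (lookup) renaming (_∷_ to _∷ᵛ_; [] to []ᵛ)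
open import Function using (_∘_)
open import Relation.Binary.Definitions using (tri<; tri≈; tri>)
open import Relation.Binary.PropositionalEquality using (_≡_; _≢_; _≗_; refl; sym; trans; cong; cong₂; subst; subst₂; module ≡-Reasoning)
open import Relation.Nullary using (does; yes; no)
open import Relation.Nullary.Decidable using (dec-true; dec-false)
open import Relation.Unary using (Pred; Decidable; _⊆_)

open import Defs

count₀ : List Bool → ℕ
count₀ []           = 0
count₀ (false ∷ bs) = suc (count₀ bs)
count₀ (true  ∷ bs) = count₀ bs

count₁ : List Bool → ℕ
count₁ []           = 0
count₁ (false ∷ bs) = count₁ bs
count₁ (true  ∷ bs) = suc (count₁ bs)

count₀+count₁≡length : ∀ bs → count₀ bs + count₁ bs ≡ length bs
count₀+count₁≡length []           = refl
count₀+count₁≡length (false ∷ bs) = cong suc (count₀+count₁≡length bs)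
count₀+count₁≡length (true  ∷ bs) = trans (+-suc (count₀ bs) (count₁ bs)) (cong suc (count₀+count₁≡length bs))

zeros++ones : ℕ → ℕ → List ℤ
zeros++ones a b = replicate a 0ℤ ++ replicate b 1ℤ

↭-zeros++ones : ∀ bs → map toInt bs ↭ zeros++ones (count₀ bs) (count₁ bs)
↭-zeros++ones []           = _↭_.refl
↭-zeros++ones (false ∷ bs) = prep 0ℤ (↭-zeros++ones bs)
↭-zeros++ones (true  ∷ bs) =
  ↭-trans (prep 1ℤ (↭-zeros++ones bs)) (↭-sym (shift 1ℤ (replicate (count₀ bs) 0ℤ) _))

ones-↗ : ∀ b → Sorted ≤-totalOrder (replicate b 1ℤ)
ones-↗ zero          = []
ones-↗ (suc zero)    = [-]
ones-↗ (suc (suc b)) = +≤+ (s≤s z≤n) ∷ ones-↗ (suc b)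

zeros++ones-↗ : ∀ a b → Sorted ≤-totalOrder (zeros++ones a b)
zeros++ones-↗ zero          b       = ones-↗ b
zeros++ones-↗ (suc zero)    zero    = [-]
zeros++ones-↗ (suc zero)    (suc b) = +≤+ z≤n ∷ ones-↗ (suc b)
zeros++ones-↗ (suc (suc a)) b       = +≤+ z≤n ∷ zeros++ones-↗ (suc a) b

sort-binary : ∀ bs → sort (map toInt bs) ≡ zeros++ones (count₀ bs) (count₁ bs)
sort-binary bs = Pointwise-≡⇒≡ (↗↭↗⇒≋ ≤-totalOrder (sort-↗ _) (zeros++ones-↗ (count₀ bs) (count₁ bs))
  (↭⇒↭ₛ (↭-trans (sort-↭ _) (↭-zeros++ones bs))))

does-≤?-suc : ∀ a m → does (suc a ≤? suc m) ≡ does (a ≤? m)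
does-≤?-suc a m with a ≤? m
... | yes a≤m = trans (dec-true (suc a ≤? suc m) (s≤s a≤m)) (sym (dec-true (a ≤? m) a≤m))
... | no a≰m  = trans (dec-false (suc a ≤? suc m) (a≰m ∘ s≤s⁻¹)) (sym (dec-false (a ≤? m) a≰m))

does-≤?-≢ : ∀ a m → m ≢ a → does (suc a ≤? m) ≡ does (a ≤? m)
does-≤?-≢ a m m≢a with a ≤? m
... | yes a≤m = trans (dec-true (suc a ≤? m) (≤∧≢⇒< a≤m (m≢a ∘ sym))) (sym (dec-true (a ≤? m) a≤m))
... | no a≰m  = trans (dec-false (suc a ≤? m) (a≰m ∘ <⇒≤)) (sym (dec-false (a ≤? m) a≰m))

nth-zeros++ones : ∀ a b m → m < a + b → nth (zeros++ones a b) m ≡ toInt (does (a ≤? m))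
nth-zeros++ones zero    (suc b)       zero    _       = refl
nth-zeros++ones zero    (suc (suc b)) (suc m) (s≤s p) = nth-zeros++ones zero (suc b) m p
nth-zeros++ones (suc a) b             zero    _       = refl
nth-zeros++ones (suc a) b             (suc m) (s≤s p) =
  trans (nth-zeros++ones a b m p) (cong toInt (sym (does-≤?-suc a m)))

module _ {a p q} {A : Set a} {P : Pred A p} {Q : Pred A q} (P? : Decidable P) (Q? : Decidable Q) where

  filter-filter : P ⊆ Q → filter P? ∘ filter Q? ≗ filter P?
  filter-filter P⊆Q [] = refl
  filter-filter P⊆Q (x ∷ xs) with Q? x
  ... | yes _ with P? x
  ...   | yes _ = cong (x ∷_) (filter-filter P⊆Q xs)
  ...   | no  _ = filter-filter P⊆Q xs
  filter-filter P⊆Q (x ∷ xs) | no ¬Qx = trans (filter-filter P⊆Q xs) (sym (filter-reject P? (¬Qx ∘ P⊆Q)))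

rank : ∀ {n} → List (Fin n) → Fin n → ℕ
rank K i = length (filter (_<ᶠ? i) K)

module _ {n} {K : List (Fin n)} where

  rank<length : ∀ {i} → i ∈ K → rank K i < length K
  rank<length {i} i∈K = filter-notAll (_<ᶠ? i) K (Any.map (λ { refl → n≮n (toℕ i) }) i∈K)

  rank-< : ∀ {i j} → i ∈ K → i <ᶠ j → rank K i < rank K j
  rank-< {i} {j} i∈K i<j = begin-strict
    rank K i                                     ≡⟨ cong length (filter-filter (_<ᶠ? i) (_<ᶠ? j) (λ k<i → <-trans k<i i<j) K) ⟨
    length (filter (_<ᶠ? i) (filter (_<ᶠ? j) K)) <⟨ filter-notAll (_<ᶠ? i) _ (Any.map (λ { refl → n≮n (toℕ i) }) (∈-filter⁺ (_<ᶠ? j) i∈K i<j)) ⟩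
    rank K j                                     ∎
    where open ≤-Reasoning

  rank-injective : ∀ {i j} → i ∈ K → j ∈ K → rank K i ≡ rank K j → i ≡ j
  rank-injective {i} {j} i∈K j∈K eq with <-cmp i j
  ... | tri< i<j _ _ = ⊥-elim (<⇒≢ (rank-< i∈K i<j) eq)
  ... | tri≈ _ i≡j _ = i≡j
  ... | tri> _ _ j<i = ⊥-elim (<⇒≢ (rank-< j∈K j<i) (sym eq))

rank-surjective : ∀ {n} {K : List (Fin n)} → AllPairs _<ᶠ_ K → ∀ m → m < length K → ∃[ i ] (i ∈ K × rank K i ≡ m)
rank-surjective {K = k ∷ K} (k<K ∷ _) zero _ = k , here refl ,
  trans (cong length (filter-reject (_<ᶠ? k) (n≮n (toℕ k))))
        (cong length (filter-none (_<ᶠ? k) (All.map (λ k<j j<k → n≮n (toℕ k) (<-trans k<j j<k)) k<K)))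
rank-surjective {K = k ∷ K} (k<K ∷ K↗) (suc m) (s≤s m<|K|) with rank-surjective K↗ m m<|K|
... | i , i∈K , rank-i = i , there i∈K ,
  trans (cong length (filter-accept (_<ᶠ? i) (All.lookup k<K i∈K))) (cong suc rank-i)

module _ {n} (L : Layer n) where

  comparatorOf-cong : ∀ {i j} → L i ≡ L j → comparatorOf L i ≡ comparatorOf L j
  comparatorOf-cong e = cong (λ c → filter (λ k → L k ≟ c) (allFin n)) e

  ∈-comparatorOf⁺ : ∀ {i j} → L j ≡ L i → j ∈ comparatorOf L i
  ∈-comparatorOf⁺ {i} {j} e = ∈-filter⁺ (λ k → L k ≟ L i) (∈-allFin j) e

  ∈-comparatorOf⁻ : ∀ {i j} → j ∈ comparatorOf L i → L j ≡ L i
  ∈-comparatorOf⁻ {i} j∈ = proj₂ (∈-filter⁻ (λ k → L k ≟ L i) {xs = allFin n} j∈)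

  comparatorOf-↗ : ∀ i → AllPairs _<ᶠ_ (comparatorOf L i)
  comparatorOf-↗ i = AllPairs.filter⁺ (λ k → L k ≟ L i) (AllPairs.tabulate⁺-< (λ i<j → i<j))

  rank-<-comparator : ∀ {i j} → L i ≡ L j → i <ᶠ j → rank (comparatorOf L i) i < rank (comparatorOf L j) j
  rank-<-comparator e i<j rewrite comparatorOf-cong e = rank-< (∈-comparatorOf⁺ e) i<j

zerosIn : ∀ {n} → (Fin n → Bool) → List (Fin n) → ℕ
zerosIn w K = count₀ (map w K)

-- A comparator holding z zeros outputs 0 exactly on its first z cells.
layerᵇ : ∀ {n} → Layer n → (Fin n → Bool) → Fin n → Bool
layerᵇ L w i = does (zerosIn w (comparatorOf L i) ≤? rank (comparatorOf L i) i)

arraysᵇ : ∀ {n d} → Network n d → (Fin n → Bool) → Fin (suc d) → Fin n → Bool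
arraysᵇ N        w zero    = w
arraysᵇ (L ∷ᵛ N) w (suc a) = arraysᵇ N (layerᵇ L w) a

applyLayer-embed : ∀ {n} (L : Layer n) w i → applyLayer L (embed w) i ≡ toInt (layerᵇ L w i)
applyLayer-embed L w i = begin
  nth (sort (map (embed w) K)) (rank K i)            ≡⟨ cong (λ vs → nth (sort vs) (rank K i)) (map-∘ K) ⟩
  nth (sort (map toInt (map w K))) (rank K i)        ≡⟨ cong (λ vs → nth vs (rank K i)) (sort-binary (map w K)) ⟩
  nth (zeros++ones (zerosIn w K) (count₁ (map w K))) (rank K i)
                                                     ≡⟨ nth-zeros++ones (zerosIn w K) (count₁ (map w K)) (rank K i) rank<count ⟩
  toInt (layerᵇ L w i)                               ∎
  where
    open ≡-Reasoning
    K = comparatorOf L i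
    rank<count : rank K i < zerosIn w K + count₁ (map w K)
    rank<count rewrite count₀+count₁≡length (map w K) | length-map w K = rank<length (∈-comparatorOf⁺ L refl)

applyLayer-cong : ∀ {n} (L : Layer n) {v v′ : Array n} → v ≗ v′ → applyLayer L v ≗ applyLayer L v′
applyLayer-cong L v≗v′ i = cong (λ vs → nth (sort vs) (rank (comparatorOf L i) i)) (map-cong v≗v′ (comparatorOf L i))

layerᵇ-cong : ∀ {n} (L : Layer n) {w w′ : Fin n → Bool} → w ≗ w′ → layerᵇ L w ≗ layerᵇ L w′
layerᵇ-cong L w≗w′ i = cong (λ z → does (z ≤? rank (comparatorOf L i) i)) (cong count₀ (map-cong w≗w′ (comparatorOf L i)))

arrays-embed : ∀ {n d} (N : Network n d) {v : Array n} {w} → v ≗ embed w → ∀ a → arrays N v a ≗ embed (arraysᵇ N w a)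
arrays-embed N        v≗w zero    = v≗w
arrays-embed (L ∷ᵛ N) v≗w (suc a) =
  arrays-embed N (λ i → trans (applyLayer-cong L v≗w i) (applyLayer-embed L _ i)) a

arraysᵇ-cong : ∀ {n d} (N : Network n d) {w w′ : Fin n → Bool} → w ≗ w′ → ∀ a → arraysᵇ N w a ≗ arraysᵇ N w′ a
arraysᵇ-cong N        w≗w′ zero    = w≗w′
arraysᵇ-cong (L ∷ᵛ N) w≗w′ (suc a) = arraysᵇ-cong N (layerᵇ-cong L w≗w′) a

arraysᵇ-last : ∀ {n} d (N : Network n (suc d)) w →
  arraysᵇ N w (fromℕ (suc d)) ≡ layerᵇ (lookup N (fromℕ d)) (arraysᵇ N w (inject₁ (fromℕ d)))
arraysᵇ-last zero    (L ∷ᵛ []ᵛ) w = refl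
arraysᵇ-last (suc d) (L ∷ᵛ N)   w = arraysᵇ-last d N (layerᵇ L w)

-- Changing a single zero into a one

record Flip {n} (w w′ : Fin n → Bool) (u : Fin n) : Set where
  constructor flip
  field
    off  : w u ≡ false
    on   : w′ u ≡ true
    rest : ∀ j → j ≢ u → w′ j ≡ w j

module _ {n} {w w′ : Fin n → Bool} {u} (F : Flip w w′ u) where
  open Flip F

  flip-true : ∀ j → w j ≡ true → w′ j ≡ true
  flip-true j wj with j ≟ u
  ... | yes refl with () ← trans (sym wj) off
  ... | no j≢u = trans (rest j j≢u) wj

  flip-unique : ∀ {j} → w j ≡ false → w′ j ≡ true → j ≡ u
  flip-unique {j} wj w′j with j ≟ u
  ... | yes j≡u = j≡u
  ... | no j≢u with () ← trans (sym w′j) (trans (rest j j≢u) wj)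

module _ {n} (x : BinInput n) where

  setOne-self : ∀ i → setOne x i i ≡ true
  setOne-self i = cong (λ b → if b then true else x i) (dec-true (i ≟ i) refl)

  setOne-other : ∀ {i j} → j ≢ i → setOne x i j ≡ x j
  setOne-other {i} {j} j≢i = cong (λ b → if b then true else x j) (dec-false (j ≟ i) j≢i)

  flip-setOne : ∀ {r} → x r ≡ false → Flip x (setOne x r) r
  flip-setOne {r} xr = flip xr (setOne-self r) (λ j → setOne-other)

  ≗setOne⇒flip : ∀ {y t} → x t ≡ false → y ≗ setOne x t → Flip x y t
  ≗setOne⇒flip {y} {t} xt y≗ = flip xt (trans (y≗ t) (setOne-self t)) (λ j j≢t → trans (y≗ j) (setOne-other j≢t))

  flip⇒≗setOne : ∀ {y t} → Flip x y t → y ≗ setOne x t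
  flip⇒≗setOne {t = t} F j with j ≟ t
  ... | yes refl = Flip.on F
  ... | no j≢t   = Flip.rest F j j≢t

setOne-flip : ∀ {n} {x y : BinInput n} {t r} → Flip x y t → t ≢ r → Flip (setOne x r) (setOne y r) t
setOne-flip {x = x} {y} {t} {r} (flip off on rest) t≢r =
  flip (trans (setOne-other x t≢r) off) (trans (setOne-other y t≢r) on) rest′
  where
    rest′ : ∀ j → j ≢ t → setOne y r j ≡ setOne x r j
    rest′ j j≢t with j ≟ r
    ... | yes _ = refl
    ... | no  _ = rest j j≢t

zerosIn-cong : ∀ {n} {w w′ : Fin n → Bool} K → (∀ {j} → j ∈ K → w j ≡ w′ j) → zerosIn w K ≡ zerosIn w′ K
zerosIn-cong K agree = cong count₀ (map-cong-local (All.tabulate agree))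

zerosIn-flip : ∀ {n} {w w′ : Fin n → Bool} {u K} → AllPairs _<ᶠ_ K → Flip w w′ u → u ∈ K →
  zerosIn w K ≡ suc (zerosIn w′ K)
zerosIn-flip {w = w} {w′} {K = u ∷ K} (u<K ∷ _) F (here refl) rewrite Flip.off F | Flip.on F =
  cong suc (zerosIn-cong K (λ j∈K → sym (Flip.rest F _ (<⇒≢ᶠ (All.lookup u<K j∈K) ∘ sym))))
zerosIn-flip {w = w} {w′} {K = k ∷ K} (k<K ∷ K↗) F (there u∈K)
  rewrite Flip.rest F k (<⇒≢ᶠ (All.lookup k<K u∈K)) with w k
... | false = cong suc (zerosIn-flip K↗ F u∈K)
... | true  = zerosIn-flip K↗ F u∈K

-- The zero count of u's comparator drops from z + 1 to z, so only its cell of rank z changes.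
flip-layer : ∀ {n} (L : Layer n) {w w′ : Fin n → Bool} {u} → Flip w w′ u →
  ∃[ u′ ] (Flip (layerᵇ L w) (layerᵇ L w′) u′ × L u′ ≡ L u)
flip-layer {n} L {w} {w′} {u} F = u′ , flip off′ on′ rest′ , Lu′≡Lu
  where
    K = comparatorOf L u
    z = zerosIn w′ K

    drop : zerosIn w K ≡ suc z
    drop = zerosIn-flip (comparatorOf-↗ L u) F (∈-comparatorOf⁺ L refl)

    z<|K| : z < length K
    z<|K| = begin-strict
      z                                    <⟨ n<1+n z ⟩
      suc z                                ≡⟨ drop ⟨
      zerosIn w K                          ≤⟨ m≤m+n _ _ ⟩
      zerosIn w K + count₁ (map w K)       ≡⟨ count₀+count₁≡length (map w K) ⟩
      length (map w K)                     ≡⟨ length-map w K ⟩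
      length K                             ∎
      where open ≤-Reasoning

    u′-spec = rank-surjective (comparatorOf-↗ L u) z z<|K|
    u′ = proj₁ u′-spec
    u′∈K = proj₁ (proj₂ u′-spec)
    rank-u′ = proj₂ (proj₂ u′-spec)
    Lu′≡Lu = ∈-comparatorOf⁻ L u′∈K

    layer-in-K : ∀ v {i} → L i ≡ L u → layerᵇ L v i ≡ does (zerosIn v K ≤? rank K i)
    layer-in-K v {i} e = cong (λ K′ → does (zerosIn v K′ ≤? rank K′ i)) (comparatorOf-cong L e)

    off′ : layerᵇ L w u′ ≡ false
    off′ = trans (layer-in-K w Lu′≡Lu) (trans (cong₂ (λ a b → does (a ≤? b)) drop rank-u′) (dec-false (suc z ≤? z) (n≮n z)))

    on′ : layerᵇ L w′ u′ ≡ true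
    on′ = trans (layer-in-K w′ Lu′≡Lu) (trans (cong (λ b → does (z ≤? b)) rank-u′) (dec-true (z ≤? z) ≤-refl))

    rest′ : ∀ j → j ≢ u′ → layerᵇ L w′ j ≡ layerᵇ L w j
    rest′ j j≢u′ with L j ≟ L u
    ... | yes e = begin
      layerᵇ L w′ j                         ≡⟨ layer-in-K w′ e ⟩
      does (z ≤? rank K j)                  ≡⟨ does-≤?-≢ z (rank K j) rank-j≢z ⟨
      does (suc z ≤? rank K j)              ≡⟨ cong (λ c → does (c ≤? rank K j)) drop ⟨
      does (zerosIn w K ≤? rank K j)        ≡⟨ layer-in-K w e ⟨
      layerᵇ L w j                          ∎
      where
        open ≡-Reasoning
        rank-j≢z : rank K j ≢ z
        rank-j≢z r = j≢u′ (rank-injective (∈-comparatorOf⁺ L e) u′∈K (trans r (sym rank-u′)))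
    ... | no Lj≢Lu = cong (λ c → does (c ≤? rank (comparatorOf L j) j))
      (zerosIn-cong _ (λ {k} k∈ → Flip.rest F k (λ { refl → Lj≢Lu (sym (∈-comparatorOf⁻ L k∈)) })))

flip-arrays : ∀ {n d} (N : Network n d) {w w′ : Fin n → Bool} {u} → Flip w w′ u →
  ∀ a → ∃[ u′ ] Flip (arraysᵇ N w a) (arraysᵇ N w′ a) u′
flip-arrays N        {u = u} F zero    = u , F
flip-arrays (L ∷ᵛ N)         F (suc a) = flip-arrays N (proj₁ (proj₂ (flip-layer L F))) a

-- The last zero of a sorted 0/1 array

UpClosed : ∀ {n} → (Fin n → Bool) → Set
UpClosed o = ∀ {i j} → i ≤ᶠ j → o i ≡ true → o j ≡ true

Boundary : ∀ {n} → (Fin n → Bool) → Fin n → Set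
Boundary o β = o β ≡ false × (∀ {i} → β <ᶠ i → o i ≡ true)

module _ {n} {o : Fin n → Bool} where

  boundary-unique : ∀ {β β′} → Boundary o β → Boundary o β′ → β ≡ β′
  boundary-unique {β} {β′} (oβ , after-β) (oβ′ , after-β′) with <-cmp β β′
  ... | tri< β<β′ _ _ with () ← trans (sym (after-β β<β′)) oβ′
  ... | tri≈ _ β≡β′ _ = β≡β′
  ... | tri> _ _ β′<β with () ← trans (sym (after-β′ β′<β)) oβ

  flip-boundary : ∀ {o′ β} → UpClosed o′ → Flip o o′ β → Boundary o β
  flip-boundary o′↑ (flip off on rest) =
    off , λ {i} β<i → trans (sym (rest i (<⇒≢ᶠ β<i ∘ sym))) (o′↑ (<⇒≤ β<i) on)

  boundary-moves-left : ∀ {o′ β β′} → Boundary o β → Flip o o′ β → Boundary o′ β′ → β′ <ᶠ β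
  boundary-moves-left {β = β} {β′} (_ , after-β) F (o′β′ , _) with <-cmp β′ β
  ... | tri< β′<β _ _ = β′<β
  ... | tri≈ _ refl _ with () ← trans (sym (Flip.on F)) o′β′
  ... | tri> _ _ β<β′ with () ← trans (sym (flip-true F β′ (after-β β<β′))) o′β′

toInt-≡0 : ∀ {b} → toInt b ≡ 0ℤ → b ≡ false
toInt-≡0 {false} _ = refl

toInt-≡1 : ∀ {b} → toInt b ≡ 1ℤ → b ≡ true
toInt-≡1 {true} _ = refl

toInt-≤-true : ∀ {b b′} → toInt b ≤ℤ toInt b′ → b ≡ true → b′ ≡ true
toInt-≤-true {b′ = true}  _         _ = refl
toInt-≤-true {b′ = false} (+≤+ ()) refl

module SortingNetwork {n d} (N : Network n (suc d)) (sorting : IsSorting N) where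

  lastLayer : Layer n
  lastLayer = lookup N (fromℕ d)

  penultimate : BinInput n → Fin n → Bool
  penultimate x = arraysᵇ N x (inject₁ (fromℕ d))

  outputᵇ : BinInput n → Fin n → Bool
  outputᵇ x = layerᵇ lastLayer (penultimate x)

  outputᵇ-upClosed : ∀ x → UpClosed (outputᵇ x)
  outputᵇ-upClosed x {i} {j} i≤j = toInt-≤-true (subst₂ _≤ℤ_ (output≗ i) (output≗ j) (sorting (embed x) i j i≤j))
    where
      output≗ : ∀ k → output N (embed x) k ≡ toInt (outputᵇ x k)
      output≗ k = trans (arrays-embed N (λ _ → refl) (fromℕ (suc d)) k) (cong (λ o → toInt (o k)) (arraysᵇ-last d N x))

  Access : BinInput n → Fin n → Set
  Access x a = penultimate x a ≡ false × ∃[ r ] (x r ≡ false × penultimate (setOne x r) a ≡ true)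

  hasAccess⇒access : ∀ {x a} → HasAccess N x (inject₁ (fromℕ d)) a → Access x a
  hasAccess⇒access {x} {a} (c≡0 , r , xr , c′≡1) =
    toInt-≡0 (trans (sym (penultimate≗ x)) c≡0) , r , xr , toInt-≡1 (trans (sym (penultimate≗ (setOne x r))) c′≡1)
    where
      penultimate≗ : ∀ y → arrays N (embed y) (inject₁ (fromℕ d)) a ≡ toInt (penultimate y a)
      penultimate≗ y = arrays-embed N (λ _ → refl) (inject₁ (fromℕ d)) a

  flip-penultimate : ∀ {x x′ r} → Flip x x′ r → ∃[ u ] Flip (penultimate x) (penultimate x′) u
  flip-penultimate F = flip-arrays N F (inject₁ (fromℕ d))

  flip-output : ∀ {x x′ u} → Flip (penultimate x) (penultimate x′) u →
    ∃[ β ] (Boundary (outputᵇ x) β × Flip (outputᵇ x) (outputᵇ x′) β × lastLayer β ≡ lastLayer u)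
  flip-output {x′ = x′} F with flip-layer lastLayer F
  ... | β , Fβ , e = β , flip-boundary (outputᵇ-upClosed x′) Fβ , Fβ , e

  access-flip : ∀ {x a} → Access x a → ∃[ r ] Flip (penultimate x) (penultimate (setOne x r)) a
  access-flip {x} {a} (xa , r , xr , x′a) with flip-penultimate (flip-setOne x xr)
  ... | u , F rewrite flip-unique F xa x′a = r , F

  access-boundary : ∀ {x a} → Access x a → ∃[ β ] (Boundary (outputᵇ x) β × lastLayer β ≡ lastLayer a)
  access-boundary acc with access-flip acc
  ... | _ , F with flip-output F
  ... | β , bβ , _ , e = β , bβ , e

  -- a stays accessible on y through the same coordinate r; r ≢ t because raising t leaves a at 0.
  access-persists : ∀ {x y t a} → Access x a → Flip x y t → penultimate y a ≡ false → Access y a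
  access-persists {x} {y} {t} {a} (xa , r , xr , x′a) F ya = ya , r , yr , y′a
    where
      t≢r : t ≢ r
      t≢r refl with () ← trans (sym (trans (arraysᵇ-cong N (flip⇒≗setOne x F) (inject₁ (fromℕ d)) a) x′a)) ya
      yr : y r ≡ false
      yr = trans (Flip.rest F r (t≢r ∘ sym)) xr
      y′a : penultimate (setOne y r) a ≡ true
      y′a = flip-true (proj₂ (flip-penultimate (setOne-flip F t≢r))) a x′a

  TwoAccesses : BinInput n → Set
  TwoAccesses x = ∃[ a₁ ] ∃[ a₂ ] (a₁ ≢ a₂ × Access x a₁ × Access x a₂)

  access-avoiding : ∀ {x} → TwoAccesses x → ∀ c → ∃[ a ] (a ≢ c × Access x a)
  access-avoiding (a₁ , a₂ , a₁≢a₂ , acc₁ , acc₂) c with a₁ ≟ c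
  ... | no a₁≢c  = a₁ , a₁≢c , acc₁
  ... | yes refl = a₂ , a₁≢a₂ ∘ sym , acc₂

  boundary-step : ∀ {x y t} → TwoAccesses x → Flip x y t →
    ∃[ β ] ∃[ β′ ] (Boundary (outputᵇ x) β × Boundary (outputᵇ y) β′ × lastLayer β′ ≡ lastLayer β × β′ <ᶠ β)
  boundary-step two F =
    let c , Fc                  = flip-penultimate F
        β , bβ , Fβ , _         = flip-output Fc
        a , a≢c , acc           = access-avoiding two c
        βₓ , bβₓ , Lβₓ≡La       = access-boundary acc
        β′ , bβ′ , Lβ′≡La       = access-boundary (access-persists acc F (trans (Flip.rest Fc a a≢c) (proj₁ acc)))
    in β , β′ , bβ , bβ′ , trans Lβ′≡La (trans (sym Lβₓ≡La) (cong lastLayer (boundary-unique bβₓ bβ))) ,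
       boundary-moves-left bβ Fβ bβ′

  boundary-rank : ∀ m (xs : Fin (suc m) → BinInput n) → IsGrowingBranch xs → (∀ i → TwoAccesses (xs i)) →
    ∃[ β ] (Boundary (outputᵇ (xs zero)) β × m < rank (comparatorOf lastLayer β) β)
  boundary-rank zero xs _ two =
    let _ , _ , _ , (_ , r , xr , _) , _ = two zero
        β , _ , bβ , _ , Lβ′≡Lβ , β′<β    = boundary-step (two zero) (flip-setOne (xs zero) xr)
    in β , bβ , ≤-<-trans z≤n (rank-<-comparator lastLayer Lβ′≡Lβ β′<β)
  boundary-rank (suc m) xs grows two =
    let t , xt , x₁≗                        = grows zero (suc zero) refl
        β₁ , bβ₁ , m<rank₁                   = boundary-rank m (xs ∘ suc) (λ i j e → grows (suc i) (suc j) (cong suc e)) (two ∘ suc)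
        β , β′ , bβ , bβ′ , Lβ′≡Lβ , β′<β    = boundary-step (two zero) (≗setOne⇒flip (xs zero) xt x₁≗)
        β′≡β₁                                = boundary-unique {o = outputᵇ (xs (suc zero))} bβ′ bβ₁
    in β , bβ , ≤-<-trans m<rank₁
         (rank-<-comparator lastLayer (trans (cong lastLayer (sym β′≡β₁)) Lβ′≡Lβ) (subst (_<ᶠ β) β′≡β₁ β′<β))

mainTheorem6 : (n d k : ℕ) (N : Network n (suc d)) → IsSorting N → 2 ≤ k →
    (xs : Fin (k ∸ 1) → BinInput n) → IsGrowingBranch xs →
    ((i : Fin (k ∸ 1)) → ∃[ b₁ ] ∃[ b₂ ] (b₁ ≢ b₂ ×
      HasAccess N (xs i) (inject₁ (fromℕ d)) b₁ ×
      HasAccess N (xs i) (inject₁ (fromℕ d)) b₂)) →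
    ∃[ i ] (k ≤ comparatorSize (lookup N (fromℕ d)) i)
mainTheorem6 n d zero          _ _       ()          _ _     _
mainTheorem6 n d (suc zero)    _ _       (s≤s ())    _ _     _
mainTheorem6 n d (suc (suc m)) N sorting _           xs grows access =
  let β , _ , m<rank = boundary-rank m xs grows two-accesses
  in β , ≤-<-trans m<rank (rank<length (∈-comparatorOf⁺ lastLayer refl))
  where
    open SortingNetwork N sorting
    two-accesses : ∀ i → TwoAccesses (xs i)
    two-accesses i =
      let b₁ , b₂ , b₁≢b₂ , acc₁ , acc₂ = access i
      in b₁ , b₂ , b₁≢b₂ , hasAccess⇒access acc₁ , hasAccess⇒access acc₂
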